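{- Let $n\ge 2$, $1\le \Delta\le n$ and let $c>0$ be a constant. There exists a family $\mathcal{H}=\{h:[n]\to\{0,1\}\}$ of functions such that choosing a uniformly random function from $\mathcal{H}$ takes $r=O(\log n)$ random bits, and, writing $Z_h=\{u\in[n]: h(u)=0\}$, for a uniformly random $h\in\mathcal{H}$: (1) $\Pr_h[|Z_h|\le O(n^{17/16}/\sqrt{\Delta})]\ge 2/3$, and (2) for every set $S\subseteq[n]$ with $|S|\ge\Delta$, $\Pr_h[S\cap Z_h\neq\emptyset]\ge 1-1/n^{c}$.
   Formalization: The constant $c$ ranges over the positive rationals. -}

module Defs where

open import Data.Nat using (ℕ; zero; suc; _+_)
open import Data.Bool using (Bool; true; false; if_then_else_)
open import Data.Fin using (Fin; zero; suc)
open import Data.Fin.Subset using (Subset; inside; outside; _∩_)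
open import Data.Fin.Subset.Properties using (nonempty?)
open import Data.Vec using (tabulate)
open import Relation.Nullary.Decidable using (isYes)

count : (m : ℕ) → (Fin m → Bool) → ℕ
count zero    b = 0
count (suc m) b = (if b zero then 1 else 0) + count m (λ i → b (suc i))

-- Z_h = { u ∈ [n] : h(u) = 0 }, where 0 is encoded as false.
Z : {n : ℕ} → (Fin n → Bool) → Subset n
Z h = tabulate (λ u → if h u then outside else inside)

hits : {n : ℕ} → (Fin n → Bool) → Subset n → Bool
hits h S = isYes (nonempty? (S ∩ Z h))

module Submission where

-- For ℓ = ⌊log₂ n⌋ and g = ⌊ℓ/16⌋ + 1 ≈ log₂ n^(1/16) there are two cases.
-- If ⌊log₂ Δ⌋ < g, a single seed and h ≡ 0 work: Z_h = [n] meets every nonempty set and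
-- n^16·Δ^8 = O(n^17) because Δ^8 < 2^(8g) = O(n).  Otherwise points of [n] are encoded as
-- L = ℓ + 1 bit vectors and hashed by the Toeplitz family over GF(2): a seed (a, b) selects the
-- points x with T_a x = b, where T_a is the m × L Toeplitz matrix of the key a, 2^(m+g) ≈ Δ.
-- This family is pairwise independent with marginal 2^-m, so by the second-moment method it
-- misses a fixed set of size ≥ Δ with probability ≤ 2^m/Δ ≤ 2^-g.  Taking h to vanish on the
-- union of k = 16·p independent copies (seed length O(log n)), all copies miss such a set with
-- probability ≤ 2^(-16gp) ≤ n^-p, while Markov's inequality bounds |Z_h| by 3·k·n·2^-m =
-- O(n^(17/16)/√Δ) with probability ≥ 2/3.

open import Defs
open import Data.Nat.Base
open import Data.Nat.Properties
open import Data.Nat.Logarithm using (⌊log₂_⌋; ⌊log₂⌋-mono-≤; ⌊log₂⌊n/2⌋⌋≡⌊log₂n⌋∸1; ⌊log₂[2^n]⌋≡n)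
open import Data.Nat.DivMod using (_/_; _%_; m≡m%n+[m/n]*n; m%n<n)
open import Data.Nat.Tactic.RingSolver using (solve-∀)
open import Data.Bool.Base using (Bool; true; false; not; _∧_; _∨_; _xor_; if_then_else_)
open import Data.Bool.Properties
  using (∧-zeroʳ; ∧-identityʳ; ∧-idem; ∧-distribˡ-xor; xor-identityʳ; ∧-commutativeMonoid; xor-∧-commutativeRing)
open import Data.Vec.Base using (Vec; []; _∷_; _++_; take; drop; zipWith; replicate; lookup)
open import Data.Vec.Properties using (take++drop≡id; ++-injective; ∷-injective; lookup∘tabulate; lookup⇒[]=)
open import Data.Fin.Base using (Fin; zero; suc; splitAt; _↑ˡ_; _↑ʳ_; inject≤)
open import Data.Fin.Properties using (splitAt-↑ˡ; splitAt-↑ʳ; splitAt⁻¹-↑ˡ; splitAt⁻¹-↑ʳ; inject≤-injective)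
  renaming (_≟_ to _≟ᶠ_; suc-injective to Fin-suc-injective)
open import Data.Fin.Subset using (Subset; ∣_∣; _∩_; inside; outside)
open import Data.Fin.Subset.Properties using (nonempty?; x∈p∩q⁺)
open import Data.Sum.Base using (inj₁; inj₂; [_,_])
open import Data.Product.Base using (Σ; _×_; _,_; proj₁; proj₂; map)
open import Data.Empty using (⊥-elim)
open import Relation.Nullary using (yes; no; does)
open import Relation.Nullary.Decidable using (isYes)
open import Relation.Binary.PropositionalEquality
  using (_≡_; _≢_; refl; sym; trans; cong; cong₂; subst; subst₂; module ≡-Reasoning)
open import Algebra.Bundles using (CommutativeMonoid; CommutativeRing)
open import Algebra.Properties.CommutativeSemigroup +-commutativeSemigroup
  using () renaming (interchange to +-interchange)
open import Algebra.Properties.CommutativeSemigroup (CommutativeMonoid.commutativeSemigroup ∧-commutativeMonoid)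
  using () renaming (interchange to ∧-interchange)
open import Algebra.Properties.CommutativeSemigroup (CommutativeRing.+-commutativeSemigroup xor-∧-commutativeRing)
  using () renaming (interchange to xor-interchange)

𝟙 : Bool → ℕ
𝟙 true  = 1
𝟙 false = 0

𝟙≤1 : ∀ b → 𝟙 b ≤ 1
𝟙≤1 true  = ≤-refl
𝟙≤1 false = z≤n

𝟙-∧ : ∀ a b → 𝟙 (a ∧ b) ≡ 𝟙 a * 𝟙 b
𝟙-∧ true  b = sym (+-identityʳ (𝟙 b))
𝟙-∧ false b = refl

𝟙-∨ : ∀ a b → 𝟙 (a ∨ b) ≤ 𝟙 a + 𝟙 b
𝟙-∨ true  b = s≤s z≤n
𝟙-∨ false b = ≤-refl

𝟙-not : ∀ b → 𝟙 b + 𝟙 (not b) ≡ 1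
𝟙-not true  = refl
𝟙-not false = refl

∑ᵇ : (r : ℕ) → (Vec Bool r → ℕ) → ℕ
∑ᵇ zero    f = f []
∑ᵇ (suc r) f = ∑ᵇ r (λ v → f (false ∷ v)) + ∑ᵇ r (λ v → f (true ∷ v))

∑ᵇ-cong : ∀ r {f g : Vec Bool r → ℕ} → (∀ v → f v ≡ g v) → ∑ᵇ r f ≡ ∑ᵇ r g
∑ᵇ-cong zero    f≡g = f≡g []
∑ᵇ-cong (suc r) f≡g =
  cong₂ _+_ (∑ᵇ-cong r (λ v → f≡g (false ∷ v))) (∑ᵇ-cong r (λ v → f≡g (true ∷ v)))

∑ᵇ-mono : ∀ r {f g : Vec Bool r → ℕ} → (∀ v → f v ≤ g v) → ∑ᵇ r f ≤ ∑ᵇ r g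
∑ᵇ-mono zero    f≤g = f≤g []
∑ᵇ-mono (suc r) f≤g =
  +-mono-≤ (∑ᵇ-mono r (λ v → f≤g (false ∷ v))) (∑ᵇ-mono r (λ v → f≤g (true ∷ v)))

∑ᵇ-+ : ∀ r (f g : Vec Bool r → ℕ) → ∑ᵇ r (λ v → f v + g v) ≡ ∑ᵇ r f + ∑ᵇ r g
∑ᵇ-+ zero    f g = refl
∑ᵇ-+ (suc r) f g =
  trans (cong₂ _+_ (∑ᵇ-+ r f₀ g₀) (∑ᵇ-+ r f₁ g₁)) (+-interchange (∑ᵇ r f₀) (∑ᵇ r g₀) (∑ᵇ r f₁) (∑ᵇ r g₁))
  where f₀ f₁ g₀ g₁ : Vec Bool r → ℕ
        f₀ v = f (false ∷ v)
        f₁ v = f (true ∷ v)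
        g₀ v = g (false ∷ v)
        g₁ v = g (true ∷ v)

∑ᵇ-*ˡ : ∀ r c (f : Vec Bool r → ℕ) → ∑ᵇ r (λ v → c * f v) ≡ c * ∑ᵇ r f
∑ᵇ-*ˡ zero    c f = refl
∑ᵇ-*ˡ (suc r) c f = trans (cong₂ _+_ (∑ᵇ-*ˡ r c _) (∑ᵇ-*ˡ r c _)) (sym (*-distribˡ-+ c _ _))

∑ᵇ-*ʳ : ∀ r c (f : Vec Bool r → ℕ) → ∑ᵇ r (λ v → f v * c) ≡ ∑ᵇ r f * c
∑ᵇ-*ʳ r c f = trans (∑ᵇ-cong r (λ v → *-comm (f v) c)) (trans (∑ᵇ-*ˡ r c f) (*-comm c _))

∑ᵇ-const : ∀ r c → ∑ᵇ r (λ _ → c) ≡ 2 ^ r * c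
∑ᵇ-const zero    c = sym (+-identityʳ c)
∑ᵇ-const (suc r) c = trans (cong₂ _+_ (∑ᵇ-const r c) (∑ᵇ-const r c)) (doubling (2 ^ r) c)
  where doubling : ∀ a c → a * c + a * c ≡ (2 * a) * c
        doubling = solve-∀

∑ᵇ-zero : ∀ r → ∑ᵇ r (λ _ → 0) ≡ 0
∑ᵇ-zero r = trans (∑ᵇ-const r 0) (*-zeroʳ (2 ^ r))

∑ᵇ-𝟙≤ : ∀ r (b : Vec Bool r → Bool) → ∑ᵇ r (λ v → 𝟙 (b v)) ≤ 2 ^ r
∑ᵇ-𝟙≤ r b = ≤-trans (∑ᵇ-mono r (λ v → 𝟙≤1 (b v))) (≤-reflexive (trans (∑ᵇ-const r 1) (*-identityʳ _)))

∑ᵇ-++ : ∀ a b (f : Vec Bool (a + b) → ℕ) → ∑ᵇ (a + b) f ≡ ∑ᵇ a (λ v → ∑ᵇ b (λ w → f (v ++ w)))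
∑ᵇ-++ zero    b f = refl
∑ᵇ-++ (suc a) b f = cong₂ _+_ (∑ᵇ-++ a b _) (∑ᵇ-++ a b _)

∑ᵇ-split : ∀ a b (f : Vec Bool a → Vec Bool b → ℕ) →
           ∑ᵇ (a + b) (λ s → f (take a s) (drop a s)) ≡ ∑ᵇ a (λ v → ∑ᵇ b (λ w → f v w))
∑ᵇ-split a b f = trans (∑ᵇ-++ a b _) (∑ᵇ-cong a (λ v → ∑ᵇ-cong b (λ w → halves v w)))
  where halves : ∀ v w → f (take a (v ++ w)) (drop a (v ++ w)) ≡ f v w
        halves v w with ++-injective (take a (v ++ w)) v (take++drop≡id a (v ++ w))
        ... | take≡v , drop≡w = cong₂ f take≡v drop≡w

∑ᵇ-product : ∀ a b (f : Vec Bool a → ℕ) (g : Vec Bool b → ℕ) →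
             ∑ᵇ (a + b) (λ s → f (take a s) * g (drop a s)) ≡ ∑ᵇ a f * ∑ᵇ b g
∑ᵇ-product a b f g =
  trans (∑ᵇ-split a b (λ v w → f v * g w))
        (trans (∑ᵇ-cong a (λ v → ∑ᵇ-*ˡ b (f v) g)) (∑ᵇ-*ʳ a (∑ᵇ b g) f))

∑ᵇ-sum : ∀ a b (f : Vec Bool a → ℕ) (g : Vec Bool b → ℕ) →
         ∑ᵇ (a + b) (λ s → f (take a s) + g (drop a s)) ≡ 2 ^ b * ∑ᵇ a f + 2 ^ a * ∑ᵇ b g
∑ᵇ-sum a b f g =
  trans (∑ᵇ-split a b (λ v w → f v + g w))
  (trans (∑ᵇ-cong a (λ v → trans (∑ᵇ-+ b _ _) (cong (_+ ∑ᵇ b g) (∑ᵇ-const b (f v)))))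
  (trans (∑ᵇ-+ a _ _) (cong₂ _+_ (∑ᵇ-*ˡ a (2 ^ b) f) (∑ᵇ-const a (∑ᵇ b g)))))

∑ᶠ : (n : ℕ) → (Fin n → ℕ) → ℕ
∑ᶠ zero    f = 0
∑ᶠ (suc n) f = f zero + ∑ᶠ n (λ i → f (suc i))

∑ᶠ-cong : ∀ n {f g : Fin n → ℕ} → (∀ i → f i ≡ g i) → ∑ᶠ n f ≡ ∑ᶠ n g
∑ᶠ-cong zero    f≡g = refl
∑ᶠ-cong (suc n) f≡g = cong₂ _+_ (f≡g zero) (∑ᶠ-cong n (λ i → f≡g (suc i)))

∑ᶠ-mono : ∀ n {f g : Fin n → ℕ} → (∀ i → f i ≤ g i) → ∑ᶠ n f ≤ ∑ᶠ n g
∑ᶠ-mono zero    f≤g = z≤n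
∑ᶠ-mono (suc n) f≤g = +-mono-≤ (f≤g zero) (∑ᶠ-mono n (λ i → f≤g (suc i)))

∑ᶠ-+ : ∀ n (f g : Fin n → ℕ) → ∑ᶠ n (λ i → f i + g i) ≡ ∑ᶠ n f + ∑ᶠ n g
∑ᶠ-+ zero    f g = refl
∑ᶠ-+ (suc n) f g =
  trans (cong (f zero + g zero +_) (∑ᶠ-+ n _ _)) (+-interchange (f zero) (g zero) (∑ᶠ n (λ i → f (suc i))) (∑ᶠ n (λ i → g (suc i))))

∑ᶠ-*ˡ : ∀ n c (f : Fin n → ℕ) → ∑ᶠ n (λ i → c * f i) ≡ c * ∑ᶠ n f
∑ᶠ-*ˡ zero    c f = sym (*-zeroʳ c)
∑ᶠ-*ˡ (suc n) c f = trans (cong (c * f zero +_) (∑ᶠ-*ˡ n c _)) (sym (*-distribˡ-+ c _ _))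

∑ᶠ-*ʳ : ∀ n c (f : Fin n → ℕ) → ∑ᶠ n (λ i → f i * c) ≡ ∑ᶠ n f * c
∑ᶠ-*ʳ n c f = trans (∑ᶠ-cong n (λ i → *-comm (f i) c)) (trans (∑ᶠ-*ˡ n c f) (*-comm c _))

∑ᶠ-const : ∀ n c → ∑ᶠ n (λ _ → c) ≡ n * c
∑ᶠ-const zero    c = refl
∑ᶠ-const (suc n) c = cong (c +_) (∑ᶠ-const n c)

∑ᶠ-∑ᵇ : ∀ n r (f : Fin n → Vec Bool r → ℕ) →
        ∑ᶠ n (λ i → ∑ᵇ r (f i)) ≡ ∑ᵇ r (λ v → ∑ᶠ n (λ i → f i v))
∑ᶠ-∑ᵇ zero    r f = sym (∑ᵇ-zero r)
∑ᶠ-∑ᵇ (suc n) r f = trans (cong (∑ᵇ r (f zero) +_) (∑ᶠ-∑ᵇ n r (λ i → f (suc i)))) (sym (∑ᵇ-+ r _ _))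

∑ᶠ-square : ∀ n (f : Fin n → ℕ) → ∑ᶠ n f * ∑ᶠ n f ≡ ∑ᶠ n (λ i → ∑ᶠ n (λ j → f i * f j))
∑ᶠ-square n f = trans (sym (∑ᶠ-*ʳ n (∑ᶠ n f) f)) (∑ᶠ-cong n (λ i → sym (∑ᶠ-*ˡ n (f i) f)))

∑ᶠ-split : ∀ a b (f : Fin (a + b) → ℕ) → ∑ᶠ (a + b) f ≡ ∑ᶠ a (λ i → f (i ↑ˡ b)) + ∑ᶠ b (λ j → f (a ↑ʳ j))
∑ᶠ-split zero    b f = refl
∑ᶠ-split (suc a) b f = trans (cong (f zero +_) (∑ᶠ-split a b (λ i → f (suc i)))) (sym (+-assoc (f zero) _ _))

count≡∑ᶠ : ∀ m (b : Fin m → Bool) → count m b ≡ ∑ᶠ m (λ i → 𝟙 (b i))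
count≡∑ᶠ zero    b = refl
count≡∑ᶠ (suc m) b = cong₂ _+_ (if-𝟙 (b zero)) (count≡∑ᶠ m (λ i → b (suc i)))
  where if-𝟙 : ∀ x → (if x then 1 else 0) ≡ 𝟙 x
        if-𝟙 true  = refl
        if-𝟙 false = refl

count-single : (b : Fin 1 → Bool) → count 1 b ≡ 𝟙 (b zero)
count-single b = trans (count≡∑ᶠ 1 b) (+-identityʳ (𝟙 (b zero)))

-- Fin (m + 0) is Fin m up to the unit law of addition, which is not definitional.
unpad : ∀ {m} → Fin (m + 0) → Fin m
unpad {suc m} zero    = zero
unpad {suc m} (suc i) = suc (unpad i)

unpad-injective : ∀ {m} (i j : Fin (m + 0)) → unpad i ≡ unpad j → i ≡ j
unpad-injective {suc m} zero    zero    _  = refl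
unpad-injective {suc m} (suc i) (suc j) eq = cong suc (unpad-injective i j (Fin-suc-injective eq))

∑ᶠ-unpad : ∀ m (f : Fin m → ℕ) → ∑ᶠ (m + 0) (λ i → f (unpad i)) ≡ ∑ᶠ m f
∑ᶠ-unpad zero    f = refl
∑ᶠ-unpad (suc m) f = cong (f zero +_) (∑ᶠ-unpad m (λ i → f (suc i)))

-- The binary expansion of a seed i : Fin (2 ^ r), most significant bit first:
-- the first half of Fin (2 ^ suc r) = Fin (2 ^ r + (2 ^ r + 0)) starts with false.
bits : (r : ℕ) → Fin (2 ^ r) → Vec Bool r
bits zero    _ = []
bits (suc r) i =
  [ (λ j → false ∷ bits r j) , (λ j → true ∷ bits r (unpad j)) ] (splitAt (2 ^ r) i)

-- bits is a bijection, so summing over seeds is summing over bit strings.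
∑ᶠ-bits : ∀ r (f : Vec Bool r → ℕ) → ∑ᶠ (2 ^ r) (λ i → f (bits r i)) ≡ ∑ᵇ r f
∑ᶠ-bits zero    f = +-identityʳ (f [])
∑ᶠ-bits (suc r) f = trans (∑ᶠ-split (2 ^ r) (2 ^ r + 0) _) (cong₂ _+_ firstHalf secondHalf)
  where
  N : ℕ
  N = 2 ^ r
  firstHalf : ∑ᶠ N (λ j → f (bits (suc r) (j ↑ˡ (N + 0)))) ≡ ∑ᵇ r (λ v → f (false ∷ v))
  firstHalf = trans (∑ᶠ-cong N (λ j → cong (λ x → f ([ _ , _ ] x)) (splitAt-↑ˡ N j (N + 0))))
                    (∑ᶠ-bits r (λ v → f (false ∷ v)))
  secondHalf : ∑ᶠ (N + 0) (λ j → f (bits (suc r) (N ↑ʳ j))) ≡ ∑ᵇ r (λ v → f (true ∷ v))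
  secondHalf = trans (∑ᶠ-cong (N + 0) (λ j → cong (λ x → f ([ _ , _ ] x)) (splitAt-↑ʳ N (N + 0) j)))
                     (trans (∑ᶠ-unpad N (λ j → f (true ∷ bits r j))) (∑ᶠ-bits r (λ v → f (true ∷ v))))

bits-injective : ∀ r (i j : Fin (2 ^ r)) → bits r i ≡ bits r j → i ≡ j
bits-injective zero    zero zero _ = refl
bits-injective (suc r) i j eq with splitAt (2 ^ r) i in eqᵢ | splitAt (2 ^ r) j in eqⱼ
... | inj₁ a | inj₁ b = trans (sym (splitAt⁻¹-↑ˡ eqᵢ))
    (trans (cong (_↑ˡ (2 ^ r + 0)) (bits-injective r a b (proj₂ (∷-injective eq)))) (splitAt⁻¹-↑ˡ eqⱼ))
... | inj₂ a | inj₂ b = trans (sym (splitAt⁻¹-↑ʳ eqᵢ))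
    (trans (cong (2 ^ r ↑ʳ_) (unpad-injective a b (bits-injective r _ _ (proj₂ (∷-injective eq))))) (splitAt⁻¹-↑ʳ eqⱼ))
... | inj₁ _ | inj₂ _ with () ← proj₁ (∷-injective eq)
... | inj₂ _ | inj₁ _ with () ← proj₁ (∷-injective eq)

allFin : ∀ n → (Fin n → Bool) → Bool
allFin zero    P = true
allFin (suc n) P = P zero ∧ allFin n (λ i → P (suc i))

allFin-cong : ∀ n {P Q : Fin n → Bool} → (∀ i → P i ≡ Q i) → allFin n P ≡ allFin n Q
allFin-cong zero    P≡Q = refl
allFin-cong (suc n) P≡Q = cong₂ _∧_ (P≡Q zero) (allFin-cong n (λ i → P≡Q (suc i)))

allFin-∧ : ∀ n (P Q : Fin n → Bool) → allFin n (λ i → P i ∧ Q i) ≡ allFin n P ∧ allFin n Q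
allFin-∧ zero    P Q = refl
allFin-∧ (suc n) P Q =
  trans (cong ((P zero ∧ Q zero) ∧_) (allFin-∧ n (λ i → P (suc i)) (λ i → Q (suc i))))
        (∧-interchange (P zero) (Q zero) (allFin n (λ i → P (suc i))) (allFin n (λ i → Q (suc i))))

disjoint : ∀ {n} → (Fin n → Bool) → (Fin n → Bool) → Bool
disjoint {n} S T = allFin n (λ u → not (S u ∧ T u))

disjoint-∪ : ∀ {n} (S T T′ : Fin n → Bool) →
             disjoint S (λ u → T u ∨ T′ u) ≡ disjoint S T ∧ disjoint S T′
disjoint-∪ {n} S T T′ =
  trans (allFin-cong n (λ u → not-∧-∨ (S u) (T u) (T′ u)))
        (allFin-∧ n (λ u → not (S u ∧ T u)) (λ u → not (S u ∧ T′ u)))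
  where not-∧-∨ : ∀ s t t′ → not (s ∧ (t ∨ t′)) ≡ not (s ∧ t) ∧ not (s ∧ t′)
        not-∧-∨ false t     t′ = refl
        not-∧-∨ true  true  t′ = refl
        not-∧-∨ true  false t′ = refl

disjoint-∅ : ∀ {n} (S : Fin n → Bool) → disjoint S (λ _ → false) ≡ true
disjoint-∅ {zero}  S = refl
disjoint-∅ {suc n} S = cong₂ _∧_ (cong not (∧-zeroʳ (S zero))) (disjoint-∅ (λ i → S (suc i)))

disjoint⇒∩-empty : ∀ n (S T : Fin n → Bool) → disjoint S T ≡ true → ∑ᶠ n (λ u → 𝟙 (S u ∧ T u)) ≡ 0
disjoint⇒∩-empty zero    S T _ = refl
disjoint⇒∩-empty (suc n) S T eq with S zero ∧ T zero
... | false = disjoint⇒∩-empty n (λ i → S (suc i)) (λ i → T (suc i)) eq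

¬disjoint⇒common : ∀ {n} (S T : Fin n → Bool) → disjoint S T ≡ false →
                   Σ (Fin n) λ u → S u ≡ true × T u ≡ true
¬disjoint⇒common {suc n} S T eq with S zero in s₀ | T zero in t₀
... | true  | true  = zero , s₀ , t₀
... | true  | false = map suc (λ p → p) (¬disjoint⇒common (λ i → S (suc i)) (λ i → T (suc i)) eq)
... | false | _     = map suc (λ p → p) (¬disjoint⇒common (λ i → S (suc i)) (λ i → T (suc i)) eq)

_⊕_ : ∀ {L} → Vec Bool L → Vec Bool L → Vec Bool L
_⊕_ = zipWith _xor_
infixl 6 _⊕_

nonzero : ∀ {L} → Vec Bool L → Bool
nonzero []       = false
nonzero (x ∷ xs) = x ∨ nonzero xs

_==ᵇ_ : Bool → Bool → Bool
x ==ᵇ y = not (x xor y)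
infix 4 _==ᵇ_ _==_

_==_ : ∀ {m} → Vec Bool m → Vec Bool m → Bool
[]       == []       = true
(x ∷ xs) == (y ∷ ys) = (x ==ᵇ y) ∧ (xs == ys)

⊕-nonzero : ∀ {L} (x y : Vec Bool L) → nonzero (x ⊕ y) ≡ false → x ≡ y
⊕-nonzero []          []          _  = refl
⊕-nonzero (false ∷ x) (false ∷ y) eq = cong (false ∷_) (⊕-nonzero x y eq)
⊕-nonzero (true ∷ x)  (true ∷ y)  eq = cong (true ∷_) (⊕-nonzero x y eq)

==-⊕ : ∀ {m} (c d : Vec Bool m) → (c == d) ≡ ((c ⊕ d) == replicate m false)
==-⊕ []       []       = refl
==-⊕ (x ∷ c) (y ∷ d) = cong₂ _∧_ (cong not (sym (xor-identityʳ (x xor y)))) (==-⊕ c d)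

∑ᵇ-sift : ∀ m (c : Vec Bool m) (P : Vec Bool m → Bool) → ∑ᵇ m (λ b → 𝟙 ((c == b) ∧ P b)) ≡ 𝟙 (P c)
∑ᵇ-sift zero    []          P = refl
∑ᵇ-sift (suc m) (false ∷ c) P =
  trans (cong₂ _+_ (∑ᵇ-sift m c (λ w → P (false ∷ w))) (∑ᵇ-zero m)) (+-identityʳ _)
∑ᵇ-sift (suc m) (true ∷ c)  P = cong₂ _+_ (∑ᵇ-zero m) (∑ᵇ-sift m c (λ w → P (true ∷ w)))

-- The inner product over GF(2) of a key a with a point x; a key shorter than x
-- is padded with zeros, a longer one is truncated.
infix 7 _·_
_·_ : ∀ {A L} → Vec Bool A → Vec Bool L → Bool
[]       · _        = false
(a ∷ as) · []       = false
(a ∷ as) · (x ∷ xs) = (a ∧ x) xor (as · xs)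

·-linear : ∀ {A L} (a : Vec Bool A) (x y : Vec Bool L) → a · (x ⊕ y) ≡ (a · x) xor (a · y)
·-linear []       x        y        = refl
·-linear (a ∷ as) []       []       = refl
·-linear (a ∷ as) (x ∷ xs) (y ∷ ys) =
  trans (cong₂ _xor_ (∧-distribˡ-xor a x y) (·-linear as xs ys))
        (xor-interchange (a ∧ x) (a ∧ y) (as · xs) (as · ys))

shift : ∀ {A} → Vec Bool A → Vec Bool (pred A)
shift []       = []
shift (a ∷ as) = as

·-shift : ∀ {A L} (a : Vec Bool A) (z : Vec Bool L) → a · (false ∷ z) ≡ shift a · z
·-shift []       z = refl
·-shift (a ∷ as) z = cong (_xor (as · z)) (∧-zeroʳ a)

-- The m × L Toeplitz matrix over GF(2) whose rows are the windows of the key a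
-- (row i is a shifted i times), applied to the point x.
toeplitz : ∀ {A L} m → Vec Bool A → Vec Bool L → Vec Bool m
toeplitz zero    a x = []
toeplitz (suc m) a x = (a · x) ∷ toeplitz m (shift a) x

toeplitz-linear : ∀ {A L} m (a : Vec Bool A) (x y : Vec Bool L) →
                  toeplitz m a (x ⊕ y) ≡ toeplitz m a x ⊕ toeplitz m a y
toeplitz-linear zero    a x y = refl
toeplitz-linear (suc m) a x y = cong₂ _∷_ (·-linear a x y) (toeplitz-linear m (shift a) x y)

toeplitz-shift : ∀ {A L} m (a : Vec Bool A) (z : Vec Bool L) → toeplitz m a (false ∷ z) ≡ toeplitz m (shift a) z
toeplitz-shift zero    a z = refl
toeplitz-shift (suc m) a z = cong₂ _∷_ (·-shift a z) (toeplitz-shift m (shift a) z)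

==ᵇ-complement : ∀ d t e → 𝟙 ((d ==ᵇ t) ∧ e) + 𝟙 ((not d ==ᵇ t) ∧ e) ≡ 𝟙 e
==ᵇ-complement false false e = +-identityʳ (𝟙 e)
==ᵇ-complement false true  e = refl
==ᵇ-complement true  false e = refl
==ᵇ-complement true  true  e = +-identityʳ (𝟙 e)

toeplitz-uniform : ∀ A m {L} (z : Vec Bool L) → nonzero z ≡ true → m + L ≤ A → ∀ t →
                   ∑ᵇ A (λ a → 𝟙 (toeplitz m a z == t)) * 2 ^ m ≡ 2 ^ A
toeplitz-uniform A zero z _ _ [] = trans (*-identityʳ _) (trans (∑ᵇ-const A 1) (*-identityʳ _))
toeplitz-uniform zero (suc m) z _ () t
toeplitz-uniform (suc A) (suc m) (true ∷ z) _ m+L≤A (t₀ ∷ t) = begin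
    (∑ᵇ A (λ a → 𝟙 ((a · z ==ᵇ t₀) ∧ rest a)) + ∑ᵇ A (λ a → 𝟙 ((not (a · z) ==ᵇ t₀) ∧ rest a))) * 2 ^ suc m
  ≡⟨ cong (_* 2 ^ suc m) (trans (sym (∑ᵇ-+ A _ _)) (∑ᵇ-cong A (λ a → ==ᵇ-complement (a · z) t₀ (rest a)))) ⟩
    ∑ᵇ A (λ a → 𝟙 (rest a)) * (2 * 2 ^ m)
  ≡⟨ reassociate (∑ᵇ A (λ a → 𝟙 (rest a))) (2 ^ m) ⟩
    2 * (∑ᵇ A (λ a → 𝟙 (rest a)) * 2 ^ m)
  ≡⟨ cong (2 *_) (toeplitz-uniform A m (true ∷ z) refl (≤-pred m+L≤A) t) ⟩
    2 * 2 ^ A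
  ∎
  where open ≡-Reasoning
        rest : Vec Bool A → Bool
        rest a = toeplitz m a (true ∷ z) == t
        reassociate : ∀ x y → x * (2 * y) ≡ 2 * (x * y)
        reassociate = solve-∀
toeplitz-uniform (suc A) (suc m) {suc L} (false ∷ z) z≠0 m+L≤A t = begin
    (∑ᵇ A (λ a → 𝟙 (toeplitz (suc m) (false ∷ a) (false ∷ z) == t))
      + ∑ᵇ A (λ a → 𝟙 (toeplitz (suc m) (true ∷ a) (false ∷ z) == t))) * 2 ^ suc m
  ≡⟨ cong₂ (λ x y → (x + y) * 2 ^ suc m) (∑ᵇ-cong A (skip false)) (∑ᵇ-cong A (skip true)) ⟩
    (X + X) * 2 ^ suc m
  ≡⟨ +-*-distrib-double X (2 ^ suc m) ⟩
    2 * (X * 2 ^ suc m)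
  ≡⟨ cong (2 *_) (toeplitz-uniform A (suc m) z z≠0 (≤-trans (≤-reflexive (sym (+-suc m L))) (≤-pred m+L≤A)) t) ⟩
    2 * 2 ^ A
  ∎
  where open ≡-Reasoning
        X : ℕ
        X = ∑ᵇ A (λ a → 𝟙 (toeplitz (suc m) a z == t))
        skip : ∀ b a → 𝟙 (toeplitz (suc m) (b ∷ a) (false ∷ z) == t) ≡ 𝟙 (toeplitz (suc m) a z == t)
        skip b a = cong (λ v → 𝟙 (v == t)) (toeplitz-shift {suc A} (suc m) (b ∷ a) z)
        +-*-distrib-double : ∀ x y → (x + x) * y ≡ 2 * (x * y)
        +-*-distrib-double = solve-∀

∑ᵇ-== : ∀ m (c : Vec Bool m) → ∑ᵇ m (λ b → 𝟙 (c == b)) ≡ 1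
∑ᵇ-== m c = trans (∑ᵇ-cong m (λ b → cong 𝟙 (sym (∧-identityʳ (c == b))))) (∑ᵇ-sift m c (λ _ → true))

≢⇒nonzero : ∀ {L} (x y : Vec Bool L) → x ≢ y → nonzero (x ⊕ y) ≡ true
≢⇒nonzero x y x≢y with nonzero (x ⊕ y) in eq
... | true  = refl
... | false = ⊥-elim (x≢y (⊕-nonzero x y eq))

selects : ∀ A m {L} → Vec Bool (A + m) → Vec Bool L → Bool
selects A m s x = toeplitz m (take A s) x == drop A s

selects-single : ∀ A m {L} (x : Vec Bool L) →
                 ∑ᵇ (A + m) (λ s → 𝟙 (selects A m s x)) * 2 ^ m ≡ 2 ^ (A + m)
selects-single A m x = begin
    ∑ᵇ (A + m) (λ s → 𝟙 (selects A m s x)) * 2 ^ m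
  ≡⟨ cong (_* 2 ^ m) (∑ᵇ-split A m (λ a b → 𝟙 (toeplitz m a x == b))) ⟩
    ∑ᵇ A (λ a → ∑ᵇ m (λ b → 𝟙 (toeplitz m a x == b))) * 2 ^ m
  ≡⟨ cong (_* 2 ^ m) (trans (∑ᵇ-cong A (λ a → ∑ᵇ-== m (toeplitz m a x))) (∑ᵇ-const A 1)) ⟩
    2 ^ A * 1 * 2 ^ m
  ≡⟨ cong (_* 2 ^ m) (*-identityʳ (2 ^ A)) ⟩
    2 ^ A * 2 ^ m
  ≡⟨ ^-distribˡ-+-* 2 A m ⟨
    2 ^ (A + m)
  ∎
  where open ≡-Reasoning

selects-pair : ∀ A m {L} (x y : Vec Bool L) → x ≢ y → m + L ≤ A →
               ∑ᵇ (A + m) (λ s → 𝟙 (selects A m s x ∧ selects A m s y)) * (2 ^ m * 2 ^ m) ≡ 2 ^ (A + m)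
selects-pair A m x y x≢y m+L≤A = begin
    ∑ᵇ (A + m) (λ s → 𝟙 (selects A m s x ∧ selects A m s y)) * (2 ^ m * 2 ^ m)
  ≡⟨ cong (_* (2 ^ m * 2 ^ m)) (∑ᵇ-split A m (λ a b → 𝟙 ((T a x == b) ∧ (T a y == b)))) ⟩
    ∑ᵇ A (λ a → ∑ᵇ m (λ b → 𝟙 ((T a x == b) ∧ (T a y == b)))) * (2 ^ m * 2 ^ m)
  ≡⟨ cong (_* (2 ^ m * 2 ^ m)) (∑ᵇ-cong A (λ a → trans (∑ᵇ-sift m (T a x) (T a y ==_)) (difference a))) ⟩
    ∑ᵇ A (λ a → 𝟙 (T a (y ⊕ x) == replicate m false)) * (2 ^ m * 2 ^ m)
  ≡⟨ *-assoc (∑ᵇ A (λ a → 𝟙 (T a (y ⊕ x) == replicate m false))) (2 ^ m) (2 ^ m) ⟨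
    ∑ᵇ A (λ a → 𝟙 (T a (y ⊕ x) == replicate m false)) * 2 ^ m * 2 ^ m
  ≡⟨ cong (_* 2 ^ m) (toeplitz-uniform A m (y ⊕ x) (≢⇒nonzero y x (λ y≡x → x≢y (sym y≡x))) m+L≤A _) ⟩
    2 ^ A * 2 ^ m
  ≡⟨ ^-distribˡ-+-* 2 A m ⟨
    2 ^ (A + m)
  ∎
  where open ≡-Reasoning
        T : Vec Bool A → Vec Bool _ → Vec Bool m
        T = toeplitz m
        difference : ∀ a → 𝟙 (T a y == T a x) ≡ 𝟙 (T a (y ⊕ x) == replicate m false)
        difference a = cong 𝟙 (trans (==-⊕ (T a y) (T a x))
                                      (cong (_== replicate m false) (sym (toeplitz-linear m a y x))))

-- AM–GM for two naturals, first for a ≤ b = a + d, where the gap is d².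
am-gm-ordered : ∀ {a b} → a ≤ b → 2 * a * b ≤ a * a + b * b
am-gm-ordered {a} {b} a≤b = subst (λ b → 2 * a * b ≤ a * a + b * b) (m+[n∸m]≡n a≤b) (gap (b ∸ a))
  where
  square-gap : ∀ a d → 2 * a * (a + d) + d * d ≡ a * a + (a + d) * (a + d)
  square-gap = solve-∀
  gap : ∀ d → 2 * a * (a + d) ≤ a * a + (a + d) * (a + d)
  gap d = subst (2 * a * (a + d) ≤_) (square-gap a d) (m≤m+n (2 * a * (a + d)) (d * d))

am-gm : ∀ a b → 2 * a * b ≤ a * a + b * b
am-gm a b with ≤-total a b
... | inj₁ a≤b = am-gm-ordered a≤b
... | inj₂ b≤a = subst₂ _≤_ (swap b a) (+-comm (b * b) (a * a)) (am-gm-ordered b≤a)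
  where swap : ∀ b a → 2 * b * a ≡ 2 * a * b
        swap = solve-∀

-- The pointwise inequality behind the second-moment method: for a count x that
-- vanishes whenever the flag y is set,  [y]·D² + 2·M·D·x ≤ (M·x)² + D².
flagged-zero-bound : ∀ M D x y → (y ≡ true → x ≡ 0) →
                     𝟙 y * (D * D) + 2 * M * D * x ≤ (M * x) * (M * x) + D * D
flagged-zero-bound M D x true x≡0 rewrite x≡0 refl = ≤-reflexive (at-zero M D)
  where at-zero : ∀ M D → 1 * (D * D) + 2 * M * D * 0 ≡ (M * 0) * (M * 0) + D * D
        at-zero = solve-∀
flagged-zero-bound M D x false _ = subst (_≤ (M * x) * (M * x) + D * D) (rearrange M D x) (am-gm (M * x) D)
  where rearrange : ∀ M D x → 2 * (M * x) * D ≡ 0 * (D * D) + 2 * M * D * x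
        rearrange = solve-∀

-- Over the N = 2 ^ R seeds, X counts the
-- points a seed selects from a D-element set; assume the first moment M·ΣX = D·N and the
-- second moment Σ(M·X)² ≤ D²N + DMN of a selection with marginal 1/M.
second-moment-method : ∀ R M D (X : Vec Bool R → ℕ) (miss : Vec Bool R → Bool) → 1 ≤ D →
  (∀ s → miss s ≡ true → X s ≡ 0) →
  M * ∑ᵇ R X ≡ D * 2 ^ R →
  ∑ᵇ R (λ s → (M * X s) * (M * X s)) ≤ D * D * 2 ^ R + D * M * 2 ^ R →
  ∑ᵇ R (λ s → 𝟙 (miss s)) * D ≤ M * 2 ^ R
second-moment-method R M D X miss D≥1 miss⇒0 first second =
  *-cancelʳ-≤ (z * D) (M * N) D {{>-nonZero D≥1}}
    (+-cancelʳ-≤ (2 * D * D * N) ((z * D) * D) ((M * N) * D) (subst₂ _≤_ (lhs-normal z) (rhs-normal D M N) summed))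
  where
  N z : ℕ
  N = 2 ^ R
  z = ∑ᵇ R (λ s → 𝟙 (miss s))
  summed : z * (D * D) + 2 * D * (M * ∑ᵇ R X) ≤ D * D * N + D * M * N + N * (D * D)
  summed = begin
      z * (D * D) + 2 * D * (M * ∑ᵇ R X)
    ≡⟨ cong (z * (D * D) +_) (reorder M D (∑ᵇ R X)) ⟩
      z * (D * D) + 2 * M * D * ∑ᵇ R X
    ≡⟨ cong₂ _+_ (∑ᵇ-*ʳ R (D * D) _) (∑ᵇ-*ˡ R (2 * M * D) X) ⟨
      ∑ᵇ R (λ s → 𝟙 (miss s) * (D * D)) + ∑ᵇ R (λ s → 2 * M * D * X s)
    ≡⟨ ∑ᵇ-+ R _ _ ⟨
      ∑ᵇ R (λ s → 𝟙 (miss s) * (D * D) + 2 * M * D * X s)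
    ≤⟨ ∑ᵇ-mono R (λ s → flagged-zero-bound M D (X s) (miss s) (miss⇒0 s)) ⟩
      ∑ᵇ R (λ s → (M * X s) * (M * X s) + D * D)
    ≡⟨ trans (∑ᵇ-+ R _ _) (cong (∑ᵇ R (λ s → (M * X s) * (M * X s)) +_) (∑ᵇ-const R (D * D))) ⟩
      ∑ᵇ R (λ s → (M * X s) * (M * X s)) + N * (D * D)
    ≤⟨ +-monoˡ-≤ (N * (D * D)) second ⟩
      D * D * N + D * M * N + N * (D * D)
    ∎
    where open ≤-Reasoning
          reorder : ∀ M D x → 2 * D * (M * x) ≡ 2 * M * D * x
          reorder = solve-∀
  lhs-normal : ∀ z → z * (D * D) + 2 * D * (M * ∑ᵇ R X) ≡ z * D * D + 2 * D * D * N
  lhs-normal z = trans (cong (λ y → z * (D * D) + 2 * D * y) first) (regroup z D N)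
    where regroup : ∀ z D N → z * (D * D) + 2 * D * (D * N) ≡ z * D * D + 2 * D * D * N
          regroup = solve-∀
  rhs-normal : ∀ D M N → D * D * N + D * M * N + N * (D * D) ≡ M * N * D + 2 * D * D * N
  rhs-normal = solve-∀

-- A family of subsets of Fin n indexed by 2 ^ R seeds in which each point is selected
-- with probability 1/M and any two distinct points independently so.
module PairwiseIndependent
  (n R M : ℕ) (selected : Vec Bool R → Fin n → Bool)
  (single : ∀ u → ∑ᵇ R (λ s → 𝟙 (selected s u)) * M ≡ 2 ^ R)
  (pair : ∀ u v → u ≢ v → ∑ᵇ R (λ s → 𝟙 (selected s u ∧ selected s v)) * (M * M) ≡ 2 ^ R)
  where

  N : ℕ
  N = 2 ^ R

  expected-size : ∑ᵇ R (λ s → ∑ᶠ n (λ u → 𝟙 (selected s u))) * M ≡ n * N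
  expected-size = begin
      ∑ᵇ R (λ s → ∑ᶠ n (λ u → 𝟙 (selected s u))) * M
    ≡⟨ cong (_* M) (∑ᶠ-∑ᵇ n R (λ u s → 𝟙 (selected s u))) ⟨
      ∑ᶠ n (λ u → ∑ᵇ R (λ s → 𝟙 (selected s u))) * M
    ≡⟨ ∑ᶠ-*ʳ n M _ ⟨
      ∑ᶠ n (λ u → ∑ᵇ R (λ s → 𝟙 (selected s u)) * M)
    ≡⟨ trans (∑ᶠ-cong n single) (∑ᶠ-const n N) ⟩
      n * N
    ∎
    where open ≡-Reasoning

  joint-bound : ∀ u v → M * M * ∑ᵇ R (λ s → 𝟙 (selected s u ∧ selected s v)) ≤ N + 𝟙 (does (u ≟ᶠ v)) * (M * N)
  joint-bound u v with u ≟ᶠ v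
  ... | no u≢v = ≤-trans (≤-reflexive (trans (*-comm (M * M) _) (pair u v u≢v))) (m≤m+n N 0)
  ... | yes refl = ≤-trans (≤-reflexive (trans diagonal (sym (*-identityˡ (M * N))))) (m≤n+m (1 * (M * N)) N)
    where
    diagonal : M * M * ∑ᵇ R (λ s → 𝟙 (selected s u ∧ selected s u)) ≡ M * N
    diagonal = trans (cong (M * M *_) (∑ᵇ-cong R (λ s → cong 𝟙 (∧-idem (selected s u)))))
               (trans (*-assoc M M _) (cong (M *_) (trans (*-comm M _) (single u))))

  ∑ᶠ-δ : ∀ {k} (u : Fin k) → ∑ᶠ k (λ v → 𝟙 (does (u ≟ᶠ v))) ≡ 1
  ∑ᶠ-δ {suc k} zero    = cong suc (trans (∑ᶠ-const k 0) (*-zeroʳ k))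
  ∑ᶠ-δ {suc k} (suc u) = ∑ᶠ-δ u

  module _ (S : Fin n → Bool) where

    D : ℕ
    D = ∑ᶠ n (λ u → 𝟙 (S u))

    a : Fin n → Vec Bool R → ℕ
    a u s = 𝟙 (S u ∧ selected s u)

    X : Vec Bool R → ℕ
    X s = ∑ᶠ n (λ u → a u s)

    first-moment : M * ∑ᵇ R X ≡ D * N
    first-moment = begin
        M * ∑ᵇ R X
      ≡⟨ cong (M *_) (∑ᶠ-∑ᵇ n R a) ⟨
        M * ∑ᶠ n (λ u → ∑ᵇ R (a u))
      ≡⟨ trans (∑ᶠ-*ʳ n M (λ u → ∑ᵇ R (a u))) (*-comm _ M) ⟨
        ∑ᶠ n (λ u → ∑ᵇ R (a u) * M)
      ≡⟨ trans (∑ᶠ-cong n per-point) (∑ᶠ-*ʳ n N _) ⟩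
        D * N
      ∎
      where
      open ≡-Reasoning
      per-point : ∀ u → ∑ᵇ R (a u) * M ≡ 𝟙 (S u) * N
      per-point u with S u
      ... | true  = trans (single u) (sym (+-identityʳ N))
      ... | false = cong (_* M) (∑ᵇ-zero R)

    vanishing : ∀ {f : Vec Bool R → ℕ} {y} → (∀ s → f s ≡ 0) → M * M * ∑ᵇ R f ≤ y
    vanishing {f} f≡0 = ≤-trans (≤-reflexive (trans (cong (M * M *_) (trans (∑ᵇ-cong R f≡0) (∑ᵇ-zero R))) (*-zeroʳ (M * M)))) z≤n

    pair-term : ∀ u v → M * M * ∑ᵇ R (λ s → a u s * a v s) ≤ 𝟙 (S u) * 𝟙 (S v) * N + 𝟙 (S u) * (𝟙 (does (u ≟ᶠ v)) * (M * N))
    pair-term u v with S u | S v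
    ... | false | _     = vanishing (λ s → refl)
    ... | true  | false = vanishing (λ s → *-zeroʳ (𝟙 (selected s u)))
    ... | true  | true  = subst₂ _≤_ (cong (M * M *_) (∑ᵇ-cong R (λ s → 𝟙-∧ (selected s u) (selected s v))))
                                     (unit-weights N (𝟙 (does (u ≟ᶠ v))) (M * N)) (joint-bound u v)
      where unit-weights : ∀ N δ P → N + δ * P ≡ 1 * 1 * N + 1 * (δ * P)
            unit-weights = solve-∀


    row-sum : ∀ u → ∑ᶠ n (λ v → 𝟙 (S u) * 𝟙 (S v) * N + 𝟙 (S u) * (𝟙 (does (u ≟ᶠ v)) * (M * N)))
                  ≡ 𝟙 (S u) * D * N + 𝟙 (S u) * (M * N)
    row-sum u = begin
        ∑ᶠ n (λ v → 𝟙 (S u) * 𝟙 (S v) * N + 𝟙 (S u) * (𝟙 (does (u ≟ᶠ v)) * (M * N)))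
      ≡⟨ ∑ᶠ-+ n _ _ ⟩
        ∑ᶠ n (λ v → 𝟙 (S u) * 𝟙 (S v) * N) + ∑ᶠ n (λ v → 𝟙 (S u) * (𝟙 (does (u ≟ᶠ v)) * (M * N)))
      ≡⟨ cong₂ _+_ (trans (∑ᶠ-*ʳ n N _) (cong (_* N) (∑ᶠ-*ˡ n (𝟙 (S u)) _)))
                   (trans (∑ᶠ-*ˡ n (𝟙 (S u)) _) (cong (𝟙 (S u) *_) (∑ᶠ-*ʳ n (M * N) _))) ⟩
        𝟙 (S u) * D * N + 𝟙 (S u) * (∑ᶠ n (λ v → 𝟙 (does (u ≟ᶠ v))) * (M * N))
      ≡⟨ cong (λ δ → 𝟙 (S u) * D * N + 𝟙 (S u) * (δ * (M * N))) (∑ᶠ-δ u) ⟩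
        𝟙 (S u) * D * N + 𝟙 (S u) * (1 * (M * N))
      ≡⟨ cong (λ y → 𝟙 (S u) * D * N + 𝟙 (S u) * y) (*-identityˡ (M * N)) ⟩
        𝟙 (S u) * D * N + 𝟙 (S u) * (M * N)
      ∎
      where open ≡-Reasoning

    second-moment : ∑ᵇ R (λ s → (M * X s) * (M * X s)) ≤ D * D * N + D * M * N
    second-moment = begin
        ∑ᵇ R (λ s → (M * X s) * (M * X s))
      ≡⟨ trans (∑ᵇ-cong R (λ s → square-product M (X s))) (∑ᵇ-*ˡ R (M * M) _) ⟩
        M * M * ∑ᵇ R (λ s → X s * X s)
      ≡⟨ cong (M * M *_) (∑ᵇ-cong R (λ s → ∑ᶠ-square n (λ u → a u s))) ⟩
        M * M * ∑ᵇ R (λ s → ∑ᶠ n (λ u → ∑ᶠ n (λ v → a u s * a v s)))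
      ≡⟨ cong (M * M *_) (trans (∑ᶠ-cong n (λ u → ∑ᶠ-∑ᵇ n R (λ v s → a u s * a v s)))
                                   (∑ᶠ-∑ᵇ n R (λ u s → ∑ᶠ n (λ v → a u s * a v s)))) ⟨
        M * M * ∑ᶠ n (λ u → ∑ᶠ n (λ v → ∑ᵇ R (λ s → a u s * a v s)))
      ≡⟨ trans (∑ᶠ-cong n (λ u → ∑ᶠ-*ˡ n (M * M) _)) (∑ᶠ-*ˡ n (M * M) _) ⟨
        ∑ᶠ n (λ u → ∑ᶠ n (λ v → M * M * ∑ᵇ R (λ s → a u s * a v s)))
      ≤⟨ ∑ᶠ-mono n (λ u → ∑ᶠ-mono n (pair-term u)) ⟩
        ∑ᶠ n (λ u → ∑ᶠ n (λ v → 𝟙 (S u) * 𝟙 (S v) * N + 𝟙 (S u) * (𝟙 (does (u ≟ᶠ v)) * (M * N))))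
      ≡⟨ trans (∑ᶠ-cong n row-sum) (∑ᶠ-+ n _ _) ⟩
        ∑ᶠ n (λ u → 𝟙 (S u) * D * N) + ∑ᶠ n (λ u → 𝟙 (S u) * (M * N))
      ≡⟨ cong₂ _+_ (trans (∑ᶠ-*ʳ n N _) (cong (_* N) (∑ᶠ-*ʳ n D _))) (∑ᶠ-*ʳ n (M * N) _) ⟩
        D * D * N + D * (M * N)
      ≡⟨ cong (D * D * N +_) (*-assoc D M N) ⟨
        D * D * N + D * M * N
      ∎
      where open ≤-Reasoning
            square-product : ∀ M x → (M * x) * (M * x) ≡ M * M * (x * x)
            square-product = solve-∀

    miss-bound : 1 ≤ D → ∑ᵇ R (λ s → 𝟙 (disjoint S (selected s))) * D ≤ M * N
    miss-bound D≥1 = second-moment-method R M D X (λ s → disjoint S (selected s)) D≥1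
                       (λ s → disjoint⇒∩-empty n S (selected s)) first-moment second-moment

-- k independent copies of a seeded selection, selecting the union of the k sets:
-- the probabilities of missing a set multiply, the expected sizes add up.
module Repetition (n R : ℕ) (selected : Vec Bool R → Fin n → Bool) where

  union : ∀ k → Vec Bool (k * R) → Fin n → Bool
  union zero    s u = false
  union (suc k) s u = selected (take R s) u ∨ union k (drop R s) u

  -- A union misses S iff every copy does, and the copies use disjoint parts of the seed.
  union-miss : ∀ (S : Fin n → Bool) k →
    ∑ᵇ (k * R) (λ s → 𝟙 (disjoint S (union k s))) ≡ ∑ᵇ R (λ s → 𝟙 (disjoint S (selected s))) ^ k
  union-miss S zero    = cong 𝟙 (disjoint-∅ S)
  union-miss S (suc k) = begin
      ∑ᵇ (R + k * R) (λ s → 𝟙 (disjoint S (union (suc k) s)))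
    ≡⟨ ∑ᵇ-cong (R + k * R) (λ s → trans (cong 𝟙 (disjoint-∪ S (selected (take R s)) (union k (drop R s))))
                                        (𝟙-∧ (disjoint S (selected (take R s))) (disjoint S (union k (drop R s))))) ⟩
      ∑ᵇ (R + k * R) (λ s → miss₁ (take R s) * missₖ (drop R s))
    ≡⟨ ∑ᵇ-product R (k * R) miss₁ missₖ ⟩
      ∑ᵇ R miss₁ * ∑ᵇ (k * R) missₖ
    ≡⟨ cong (∑ᵇ R miss₁ *_) (union-miss S k) ⟩
      ∑ᵇ R miss₁ * ∑ᵇ R miss₁ ^ k
    ∎
    where open ≡-Reasoning
          miss₁ : Vec Bool R → ℕ
          miss₁ s = 𝟙 (disjoint S (selected s))
          missₖ : Vec Bool (k * R) → ℕ
          missₖ s = 𝟙 (disjoint S (union k s))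

  union-size : ∀ M k → ∑ᵇ R (λ s → ∑ᶠ n (λ u → 𝟙 (selected s u))) * M ≡ n * 2 ^ R →
               ∑ᵇ (k * R) (λ s → ∑ᶠ n (λ u → 𝟙 (union k s u))) * M ≤ k * n * 2 ^ (k * R)
  union-size M zero    _    = ≤-reflexive (cong (_* M) (trans (∑ᶠ-const n 0) (*-zeroʳ n)))
  union-size M (suc k) expected₁ = begin
      ∑ᵇ (R + k * R) (λ s → ∑ᶠ n (λ u → 𝟙 (union (suc k) s u))) * M
    ≤⟨ *-monoˡ-≤ M (∑ᵇ-mono (R + k * R) (λ s → ≤-trans (∑ᶠ-mono n (λ u → 𝟙-∨ (selected (take R s) u) (union k (drop R s) u)))
                                                          (≤-reflexive (∑ᶠ-+ n _ _)))) ⟩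
      ∑ᵇ (R + k * R) (λ s → size₁ (take R s) + sizeₖ (drop R s)) * M
    ≡⟨ cong (_* M) (∑ᵇ-sum R (k * R) size₁ sizeₖ) ⟩
      (2 ^ (k * R) * ∑ᵇ R size₁ + 2 ^ R * ∑ᵇ (k * R) sizeₖ) * M
    ≡⟨ distribute (2 ^ (k * R)) (∑ᵇ R size₁) (2 ^ R) (∑ᵇ (k * R) sizeₖ) M ⟩
      2 ^ (k * R) * (∑ᵇ R size₁ * M) + 2 ^ R * (∑ᵇ (k * R) sizeₖ * M)
    ≤⟨ +-mono-≤ (≤-reflexive (cong (2 ^ (k * R) *_) expected₁)) (*-monoʳ-≤ (2 ^ R) (union-size M k expected₁)) ⟩
      2 ^ (k * R) * (n * 2 ^ R) + 2 ^ R * (k * n * 2 ^ (k * R))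
    ≡⟨ collect (2 ^ (k * R)) n (2 ^ R) k ⟩
      suc k * n * (2 ^ R * 2 ^ (k * R))
    ≡⟨ cong (suc k * n *_) (^-distribˡ-+-* 2 R (k * R)) ⟨
      suc k * n * 2 ^ (R + k * R)
    ∎
    where open ≤-Reasoning
          size₁ : Vec Bool R → ℕ
          size₁ s = ∑ᶠ n (λ u → 𝟙 (selected s u))
          sizeₖ : Vec Bool (k * R) → ℕ
          sizeₖ s = ∑ᶠ n (λ u → 𝟙 (union k s u))
          distribute : ∀ a b c d M → (a * b + c * d) * M ≡ a * (b * M) + c * (d * M)
          distribute = solve-∀
          collect : ∀ a n c k → a * (n * c) + c * (k * n * a) ≡ suc k * n * (c * a)
          collect = solve-∀

<2^suc⌊log₂⌋ : ∀ x → x < 2 ^ suc ⌊log₂ x ⌋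
<2^suc⌊log₂⌋ x with 2 ^ suc ⌊log₂ x ⌋ ≤? x
... | no  2^[1+ℓ]≰x = ≰⇒> 2^[1+ℓ]≰x
... | yes 2^[1+ℓ]≤x = ⊥-elim (n≮n ⌊log₂ x ⌋
        (≤-trans (≤-reflexive (sym (⌊log₂[2^n]⌋≡n (suc ⌊log₂ x ⌋)))) (⌊log₂⌋-mono-≤ 2^[1+ℓ]≤x)))

2^⌊log₂⌋≤ : ∀ x → 1 ≤ x → 2 ^ ⌊log₂ x ⌋ ≤ x
2^⌊log₂⌋≤ x = go ⌊log₂ x ⌋ x refl
  where
  go : ∀ j x → ⌊log₂ x ⌋ ≡ j → 1 ≤ x → 2 ^ j ≤ x
  go zero    x             _   1≤x = 1≤x
  go (suc j) (suc zero)    ()  _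
  go (suc j) (suc (suc y)) log _   = begin
      2 * 2 ^ j                   ≤⟨ *-monoʳ-≤ 2 (go j (suc ⌊ y /2⌋) log-half (s≤s z≤n)) ⟩
      2 * suc ⌊ y /2⌋             ≡⟨ double-suc ⌊ y /2⌋ ⟩
      suc (suc (⌊ y /2⌋ + ⌊ y /2⌋)) ≤⟨ s≤s (s≤s (≤-trans (+-monoʳ-≤ ⌊ y /2⌋ (⌊n/2⌋≤⌈n/2⌉ y)) (≤-reflexive (⌊n/2⌋+⌈n/2⌉≡n y)))) ⟩
      suc (suc y)                 ∎
    where
    open ≤-Reasoning
    log-half : ⌊log₂ suc ⌊ y /2⌋ ⌋ ≡ j
    log-half = trans (⌊log₂⌊n/2⌋⌋≡⌊log₂n⌋∸1 (suc (suc y))) (cong (_∸ 1) log)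
    double-suc : ∀ a → 2 * suc a ≡ suc (suc (a + a))
    double-suc = solve-∀

ℓ<16*[ℓ/16+1] : ∀ ℓ → suc ℓ ≤ 16 * (ℓ / 16 + 1)
ℓ<16*[ℓ/16+1] ℓ = begin
    suc ℓ                       ≡⟨ cong suc (m≡m%n+[m/n]*n ℓ 16) ⟩
    suc (ℓ % 16 + ℓ / 16 * 16)  ≤⟨ +-monoˡ-≤ (ℓ / 16 * 16) (m%n<n ℓ 16) ⟩
    16 + ℓ / 16 * 16            ≡⟨ regroup (ℓ / 16) ⟩
    16 * (ℓ / 16 + 1)           ∎
  where open ≤-Reasoning
        regroup : ∀ d → 16 + d * 16 ≡ 16 * (d + 1)
        regroup = solve-∀

8*[ℓ/16+1]≤ℓ+8 : ∀ ℓ → 8 * (ℓ / 16 + 1) ≤ ℓ + 8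
8*[ℓ/16+1]≤ℓ+8 ℓ = begin
    8 * (ℓ / 16 + 1)            ≡⟨ regroup (ℓ / 16) ⟩
    ℓ / 16 * 8 + 8              ≤⟨ +-monoˡ-≤ 8 (*-monoʳ-≤ (ℓ / 16) (m≤m+n 8 8)) ⟩
    ℓ / 16 * 16 + 8             ≤⟨ +-monoˡ-≤ 8 (m≤n+m (ℓ / 16 * 16) (ℓ % 16)) ⟩
    ℓ % 16 + ℓ / 16 * 16 + 8    ≡⟨ cong (_+ 8) (m≡m%n+[m/n]*n ℓ 16) ⟨
    ℓ + 8                       ∎
  where open ≤-Reasoning
        regroup : ∀ d → 8 * (d + 1) ≡ d * 8 + 8
        regroup = solve-∀

^-distrib-* : ∀ a b k → (a * b) ^ k ≡ a ^ k * b ^ k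
^-distrib-* a b zero    = refl
^-distrib-* a b (suc k) = trans (cong (a * b *_) (^-distrib-* a b k)) (interchange a b (a ^ k) (b ^ k))
  where interchange : ∀ a b x y → a * b * (x * y) ≡ a * x * (b * y)
        interchange = solve-∀

exponent-bound : ∀ e m g ℓ ℓΔ → e + m ≡ suc ℓ → m + g ≡ ℓΔ → 8 * g ≤ ℓ + 8 →
                 e * 16 + suc ℓΔ * 8 ≤ 2 * 16 + ℓ * 17
exponent-bound e m g ℓ ℓΔ e+m≡1+ℓ m+g≡ℓΔ 8g≤ℓ+8 = begin
    e * 16 + suc ℓΔ * 8                   ≡⟨ cong (λ x → e * 16 + suc x * 8) m+g≡ℓΔ ⟨
    e * 16 + suc (m + g) * 8              ≡⟨ expand e m g ⟩
    (e * 16 + m * 8 + 8) + 8 * g          ≤⟨ +-mono-≤ (+-monoˡ-≤ 8 (+-monoʳ-≤ (e * 16) (*-monoʳ-≤ m (m≤m+n 8 8)))) 8g≤ℓ+8 ⟩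
    (e * 16 + m * 16 + 8) + (ℓ + 8)       ≡⟨ cong (λ x → x + 8 + (ℓ + 8)) (trans (sym (*-distribʳ-+ 16 e m)) (cong (_* 16) e+m≡1+ℓ)) ⟩
    (suc ℓ * 16 + 8) + (ℓ + 8)            ≡⟨ collect ℓ ⟩
    2 * 16 + ℓ * 17                       ∎
  where open ≤-Reasoning
        expand : ∀ e m g → e * 16 + suc (m + g) * 8 ≡ (e * 16 + m * 8 + 8) + 8 * g
        expand = solve-∀
        collect : ∀ ℓ → (suc ℓ * 16 + 8) + (ℓ + 8) ≡ 2 * 16 + ℓ * 17
        collect = solve-∀

threshold-bound : ∀ a b c C e ℓ ℓΔ Δ n → e * a + suc ℓΔ * b ≤ 2 * a + ℓ * c → Δ < 2 ^ suc ℓΔ → 2 ^ ℓ ≤ n →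
                  (C * 2 ^ e) ^ a * Δ ^ b ≤ (C * 2 ^ 2) ^ a * n ^ c
threshold-bound a b c C e ℓ ℓΔ Δ n exponents Δ< 2^ℓ≤n = begin
    (C * 2 ^ e) ^ a * Δ ^ b
  ≤⟨ *-monoʳ-≤ ((C * 2 ^ e) ^ a) (^-monoˡ-≤ b (<⇒≤ Δ<)) ⟩
    (C * 2 ^ e) ^ a * (2 ^ suc ℓΔ) ^ b
  ≡⟨ cong₂ _*_ (trans (^-distrib-* C (2 ^ e) a) (cong (C ^ a *_) (^-*-assoc 2 e a))) (^-*-assoc 2 (suc ℓΔ) b) ⟩
    C ^ a * 2 ^ (e * a) * 2 ^ (suc ℓΔ * b)
  ≡⟨ trans (*-assoc (C ^ a) _ _) (cong (C ^ a *_) (sym (^-distribˡ-+-* 2 (e * a) (suc ℓΔ * b)))) ⟩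
    C ^ a * 2 ^ (e * a + suc ℓΔ * b)
  ≤⟨ *-monoʳ-≤ (C ^ a) (^-monoʳ-≤ 2 exponents) ⟩
    C ^ a * 2 ^ (2 * a + ℓ * c)
  ≡⟨ cong (C ^ a *_) (trans (^-distribˡ-+-* 2 (2 * a) (ℓ * c)) (cong₂ _*_ (sym (^-*-assoc 2 2 a)) (sym (^-*-assoc 2 ℓ c)))) ⟩
    C ^ a * ((2 ^ 2) ^ a * (2 ^ ℓ) ^ c)
  ≤⟨ *-monoʳ-≤ (C ^ a) (*-monoʳ-≤ ((2 ^ 2) ^ a) (^-monoˡ-≤ c 2^ℓ≤n)) ⟩
    C ^ a * ((2 ^ 2) ^ a * n ^ c)
  ≡⟨ trans (sym (*-assoc (C ^ a) _ _)) (cong (_* n ^ c) (sym (^-distrib-* C (2 ^ 2) a))) ⟩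
    (C * 2 ^ 2) ^ a * n ^ c
  ∎
  where open ≤-Reasoning

-- For Δ below 2^g the trivial bound |Z| ≤ n already passes the test:
-- n^a · Δ^8 ≤ C^a · n^(a+1) whenever 2^8 ≤ C^a, Δ < 2^g, 8·g ≤ ℓ + 8 and 2^ℓ ≤ n.
small-Δ-bound : ∀ a C g ℓ Δ n → 2 ^ 8 ≤ C ^ a → Δ < 2 ^ g → 8 * g ≤ ℓ + 8 → 2 ^ ℓ ≤ n →
                n ^ a * Δ ^ 8 ≤ C ^ a * n ^ suc a
small-Δ-bound a C g ℓ Δ n 2^8≤C^a Δ< 8g≤ℓ+8 2^ℓ≤n = begin
    n ^ a * Δ ^ 8
  ≤⟨ *-monoʳ-≤ (n ^ a) (^-monoˡ-≤ 8 (<⇒≤ Δ<)) ⟩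
    n ^ a * (2 ^ g) ^ 8
  ≡⟨ cong (n ^ a *_) (trans (^-*-assoc 2 g 8) (cong (2 ^_) (*-comm g 8))) ⟩
    n ^ a * 2 ^ (8 * g)
  ≤⟨ *-monoʳ-≤ (n ^ a) (^-monoʳ-≤ 2 8g≤ℓ+8) ⟩
    n ^ a * 2 ^ (ℓ + 8)
  ≡⟨ cong (n ^ a *_) (^-distribˡ-+-* 2 ℓ 8) ⟩
    n ^ a * (2 ^ ℓ * 2 ^ 8)
  ≤⟨ *-monoʳ-≤ (n ^ a) (*-monoˡ-≤ (2 ^ 8) 2^ℓ≤n) ⟩
    n ^ a * (n * 2 ^ 8)
  ≡⟨ rotate (n ^ a) n (2 ^ 8) ⟩
    2 ^ 8 * (n * n ^ a)
  ≤⟨ *-monoˡ-≤ (n ^ suc a) 2^8≤C^a ⟩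
    C ^ a * n ^ suc a
  ∎
  where open ≤-Reasoning
        rotate : ∀ x n y → x * (n * y) ≡ y * (n * x)
        rotate = solve-∀

2^8≤C^a : ∀ a C → 8 ≤ a → 2 ≤ C → 2 ^ 8 ≤ C ^ a
2^8≤C^a a C 8≤a 2≤C = ≤-trans (^-monoʳ-≤ 2 8≤a) (^-monoˡ-≤ a 2≤C)

two-thirds : ∀ good bad N → good + bad ≡ N → 3 * bad ≤ N → 2 * N ≤ 3 * good
two-thirds good bad N good+bad≡N 3bad≤N =
  +-cancelʳ-≤ (3 * bad) (2 * N) (3 * good) (begin
    2 * N + 3 * bad        ≤⟨ +-monoʳ-≤ (2 * N) 3bad≤N ⟩
    2 * N + N              ≡⟨ cong (λ x → 2 * x + x) good+bad≡N ⟨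
    2 * (good + bad) + (good + bad)  ≡⟨ regroup good bad ⟩
    3 * good + 3 * bad     ∎)
  where open ≤-Reasoning
        regroup : ∀ x y → 2 * (x + y) + (x + y) ≡ 3 * x + 3 * y
        regroup = solve-∀

-- A failure probability c/N ≤ min(1, 1/X) is also at most X^(-1/q): c^q · X ≤ N^q.
power-tail : ∀ c N X q → 1 ≤ q → c ≤ N → c * X ≤ N → c ^ q * X ≤ N ^ q
power-tail c N X (suc q) _ c≤N cX≤N = begin
    c * c ^ q * X    ≡⟨ rotate c (c ^ q) X ⟩
    c ^ q * (c * X)  ≤⟨ *-mono-≤ (^-monoˡ-≤ q c≤N) cX≤N ⟩
    N ^ q * N        ≡⟨ *-comm (N ^ q) N ⟩
    N * N ^ q        ∎
  where open ≤-Reasoning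
        rotate : ∀ a b x → a * b * x ≡ b * (a * x)
        rotate = solve-∀

seed-length-bound : ∀ k m ℓ → m ≤ ℓ → 1 ≤ ℓ → k * ((m + suc ℓ) + m) ≤ 4 * k * ℓ
seed-length-bound k m ℓ m≤ℓ 1≤ℓ = begin
    k * ((m + suc ℓ) + m)   ≤⟨ *-monoʳ-≤ k (+-mono-≤ (+-monoˡ-≤ (suc ℓ) m≤ℓ) m≤ℓ) ⟩
    k * ((ℓ + suc ℓ) + ℓ)   ≡⟨ regroup k ℓ ⟩
    k * (1 + 3 * ℓ)         ≤⟨ *-monoʳ-≤ k (+-monoˡ-≤ (3 * ℓ) 1≤ℓ) ⟩
    k * (ℓ + 3 * ℓ)         ≡⟨ collect k ℓ ⟩
    4 * k * ℓ               ∎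
  where open ≤-Reasoning
        regroup : ∀ k ℓ → k * ((ℓ + suc ℓ) + ℓ) ≡ k * (1 + 3 * ℓ)
        regroup = solve-∀
        collect : ∀ k ℓ → k * (ℓ + 3 * ℓ) ≡ 4 * k * ℓ
        collect = solve-∀

n^p≤[2^g]^[16p] : ∀ n p g L → n ≤ 2 ^ L → L ≤ 16 * g → n ^ p ≤ (2 ^ g) ^ (16 * p)
n^p≤[2^g]^[16p] n p g L n≤2^L L≤16g = begin
    n ^ p              ≤⟨ ^-monoˡ-≤ p n≤2^L ⟩
    (2 ^ L) ^ p        ≡⟨ ^-*-assoc 2 L p ⟩
    2 ^ (L * p)        ≤⟨ ^-monoʳ-≤ 2 (*-monoˡ-≤ p L≤16g) ⟩
    2 ^ (16 * g * p)   ≡⟨ cong (2 ^_) (regroup g p) ⟩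
    2 ^ (g * (16 * p)) ≡⟨ ^-*-assoc 2 g (16 * p) ⟨
    (2 ^ g) ^ (16 * p) ∎
  where open ≤-Reasoning
        regroup : ∀ g p → 16 * g * p ≡ g * (16 * p)
        regroup = solve-∀

∣∣≡∑ᶠ : ∀ {n} (p : Subset n) → ∣ p ∣ ≡ ∑ᶠ n (λ u → 𝟙 (lookup p u))
∣∣≡∑ᶠ []          = refl
∣∣≡∑ᶠ (true ∷ p)  = cong suc (∣∣≡∑ᶠ p)
∣∣≡∑ᶠ (false ∷ p) = ∣∣≡∑ᶠ p

lookup-Z : ∀ {n} (T : Fin n → Bool) u → lookup (Z (λ v → not (T v))) u ≡ T u
lookup-Z T u = trans (lookup∘tabulate _ u) (zero-of-not (T u))
  where zero-of-not : ∀ t → (if not t then outside else inside) ≡ t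
        zero-of-not true  = refl
        zero-of-not false = refl

∣Z∣ : ∀ {n} (T : Fin n → Bool) → ∣ Z (λ u → not (T u)) ∣ ≡ ∑ᶠ n (λ u → 𝟙 (T u))
∣Z∣ {n} T = trans (∣∣≡∑ᶠ (Z (λ u → not (T u)))) (∑ᶠ-cong n (λ u → cong 𝟙 (lookup-Z T u)))

hits-if-meets : ∀ {n} (T : Fin n → Bool) (S : Subset n) → disjoint (lookup S) T ≡ false →
                hits (λ u → not (T u)) S ≡ true
hits-if-meets T S meets with ¬disjoint⇒common (lookup S) T meets
... | u , u∈S , Tu with nonempty? (S ∩ Z (λ v → not (T v)))
...   | yes _   = refl
...   | no  S∩Z≠∅ = ⊥-elim (S∩Z≠∅ (u , x∈p∩q⁺ (lookup⇒[]= u S u∈S , lookup⇒[]= u (Z _) (trans (lookup-Z T u) Tu))))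

miss-indicator : ∀ {n} (T : Fin n → Bool) (S : Subset n) →
                 𝟙 (not (hits (λ u → not (T u)) S)) ≤ 𝟙 (disjoint (lookup S) T)
miss-indicator T S with disjoint (lookup S) T in eq
... | true  = 𝟙≤1 _
... | false rewrite hits-if-meets T S eq = z≤n

markov : ∀ r (f : Vec Bool r → ℕ) (bad : Vec Bool r → Bool) T M K → 1 ≤ K →
         (∀ s → bad s ≡ true → T ≤ f s) → ∑ᵇ r f * M ≤ K * 2 ^ r → 3 * K ≤ T * M →
         3 * ∑ᵇ r (λ s → 𝟙 (bad s)) ≤ 2 ^ r
markov r f bad T M K K≥1 bad⇒large mean 3K≤TM = *-cancelˡ-≤ K {{>-nonZero K≥1}} (begin
    K * (3 * b)                       ≡⟨ reorder K b ⟩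
    b * (3 * K)                       ≤⟨ *-monoʳ-≤ b 3K≤TM ⟩
    b * (T * M)                       ≡⟨ trans (cong (_* M) (∑ᵇ-*ʳ r T (λ s → 𝟙 (bad s)))) (*-assoc b T M) ⟨
    ∑ᵇ r (λ s → 𝟙 (bad s) * T) * M    ≤⟨ *-monoˡ-≤ M (∑ᵇ-mono r large) ⟩
    ∑ᵇ r f * M                        ≤⟨ mean ⟩
    K * 2 ^ r                         ∎)
  where
  open ≤-Reasoning
  b : ℕ
  b = ∑ᵇ r (λ s → 𝟙 (bad s))
  reorder : ∀ K b → K * (3 * b) ≡ b * (3 * K)
  reorder = solve-∀
  large : ∀ s → 𝟙 (bad s) * T ≤ f s
  large s with bad s in eq
  ... | true  = ≤-trans (≤-reflexive (+-identityʳ T)) (bad⇒large s eq)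
  ... | false = z≤n

above-threshold : ∀ {T x B} a b Δ → T ^ a * Δ ^ b ≤ B → not (isYes (x ^ a * Δ ^ b ≤? B)) ≡ true → T ≤ x
above-threshold {T} {x} {B} a b Δ T-passes fails with x ^ a * Δ ^ b ≤? B
... | no x-fails = ≮⇒≥ (λ x<T → x-fails (≤-trans (*-monoˡ-≤ (Δ ^ b) (^-monoˡ-≤ a (<⇒≤ x<T))) T-passes))

isYes-≤? : ∀ {a b} → a ≤ b → isYes (a ≤? b) ≡ true
isYes-≤? {a} {b} a≤b with a ≤? b
... | yes _   = refl
... | no  a≰b = ⊥-elim (a≰b a≤b)

-- The requirements of the theorem on a family H of 2 ^ r functions [n] → {0,1}:
-- with probability ≥ 2/3 the zero set is small, |Z_h|^16 · Δ^8 ≤ C₂^16 · n^17 ...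
SmallZeroSets : (C₂ n Δ r : ℕ) → (Fin (2 ^ r) → Fin n → Bool) → Set
SmallZeroSets C₂ n Δ r H = 2 * 2 ^ r ≤ 3 * count (2 ^ r) (λ i → isYes ((∣ Z (H i) ∣ ^ 16) * Δ ^ 8 ≤? (C₂ ^ 16) * n ^ 17))

-- ... and every set of size ≥ Δ is missed with probability at most n^(-p/q).
HitsLargeSets : (p q n Δ r : ℕ) → (Fin (2 ^ r) → Fin n → Bool) → Set
HitsLargeSets p q n Δ r H = (S : Subset n) → Δ ≤ ∣ S ∣ →
  (count (2 ^ r) (λ i → not (hits (H i) S)) ^ q) * n ^ p ≤ (2 ^ r) ^ q

HashFamily : (C₁ C₂ p q n Δ : ℕ) → Set
HashFamily C₁ C₂ p q n Δ = Σ ℕ λ r → (r ≤ C₁ * ⌊log₂ n ⌋) ×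
  Σ (Fin (2 ^ r) → Fin n → Bool) λ H → SmallZeroSets C₂ n Δ r H × HitsLargeSets p q n Δ r H

meets-full : ∀ {n} (S : Subset n) → 1 ≤ ∣ S ∣ → disjoint (lookup S) (λ _ → true) ≡ false
meets-full {n} S S≠∅ with disjoint (lookup S) (λ _ → true) in eq
... | false = refl
... | true  = ⊥-elim (n≮n 0 (≤-trans S≠∅ (≤-reflexive (begin
    ∣ S ∣                                        ≡⟨ ∣∣≡∑ᶠ S ⟩
    ∑ᶠ n (λ u → 𝟙 (lookup S u))                  ≡⟨ ∑ᶠ-cong n (λ u → cong 𝟙 (∧-identityʳ (lookup S u))) ⟨
    ∑ᶠ n (λ u → 𝟙 (lookup S u ∧ true))           ≡⟨ disjoint⇒∩-empty n (lookup S) (λ _ → true) eq ⟩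
    0                                            ∎))))
  where open ≡-Reasoning

-- When Δ < 2^g ≈ n^(1/16) a single seed suffices: h ≡ 0 has Z_h = [n], which meets every
-- nonempty set, and |Z_h| = n passes the size test because Δ is small.
module TrivialFamily (p q n Δ : ℕ) (p≥1 : 1 ≤ p) (q≥1 : 1 ≤ q) (n≥2 : 2 ≤ n) (Δ≥1 : 1 ≤ Δ)
                     (ℓΔ<g : ⌊log₂ Δ ⌋ < ⌊log₂ n ⌋ / 16 + 1) where

  k : ℕ
  k = 16 * p

  H : Fin (2 ^ 0) → Fin n → Bool
  H _ _ = false

  ∣Z∣≡n : ∣ Z {n} (λ _ → false) ∣ ≡ n
  ∣Z∣≡n = trans (∣Z∣ {n} (λ _ → true)) (trans (∑ᶠ-const n 1) (*-identityʳ n))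

  2^8≤[12k]^16 : 2 ^ 8 ≤ (12 * k) ^ 16
  2^8≤[12k]^16 = 2^8≤C^a 16 (12 * k) (m≤m+n 8 8) (≤-trans (s≤s (s≤s z≤n)) (*-monoʳ-≤ 12 (≤-trans p≥1 (m≤n*m p 16))))

  passes : ∣ Z {n} (λ _ → false) ∣ ^ 16 * Δ ^ 8 ≤ (12 * k) ^ 16 * n ^ 17
  passes = subst (λ z → z ^ 16 * Δ ^ 8 ≤ (12 * k) ^ 16 * n ^ 17) (sym ∣Z∣≡n)
    (small-Δ-bound 16 (12 * k) (⌊log₂ n ⌋ / 16 + 1) ⌊log₂ n ⌋ Δ n 2^8≤[12k]^16
                   (<-≤-trans (<2^suc⌊log₂⌋ Δ) (^-monoʳ-≤ 2 ℓΔ<g)) (8*[ℓ/16+1]≤ℓ+8 ⌊log₂ n ⌋)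
                   (2^⌊log₂⌋≤ n (≤-trans (s≤s z≤n) n≥2)))

  seed-passes : Fin 1 → Bool
  seed-passes i = isYes (∣ Z (H i) ∣ ^ 16 * Δ ^ 8 ≤? (12 * k) ^ 16 * n ^ 17)

  small-zero-sets : SmallZeroSets (12 * k) n Δ 0 H
  small-zero-sets = subst (λ c → 2 * 2 ^ 0 ≤ 3 * c) (sym (trans (count-single seed-passes) (cong 𝟙 (isYes-≤? passes))))
                          (s≤s (s≤s z≤n))

  hits-large-sets : HitsLargeSets p q n Δ 0 H
  hits-large-sets S Δ≤∣S∣ = subst (λ c → c ^ q * n ^ p ≤ (2 ^ 0) ^ q) (sym never-missed) (0^q q q≥1)
    where
    never-missed : count 1 (λ _ → not (hits {n} (λ _ → false) S)) ≡ 0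
    never-missed = trans (count-single (λ _ → not (hits {n} (λ _ → false) S)))
      (cong (λ t → 𝟙 (not t)) (hits-if-meets (λ _ → true) S (meets-full S (≤-trans Δ≥1 Δ≤∣S∣))))
    0^q : ∀ q → 1 ≤ q → 0 ^ q * n ^ p ≤ (2 ^ 0) ^ q
    0^q (suc q) _ = z≤n

  family : HashFamily (4 * k) (12 * k) p q n Δ
  family = 0 , z≤n , H , small-zero-sets , hits-large-sets

-- Points are encoded with L = ℓ + 1 bits; one copy of
-- the Toeplitz family selects each point with probability 2^-m, where 2^(m+g) = 2^⌊log₂Δ⌋ ≤ Δ,
-- so by the second-moment method it misses a set of size ≥ Δ with probability ≤ 2^-g.  The
-- function h is 0 exactly on the union of k = 16·p independent copies: it misses such a set with
-- probability ≤ 2^(-16gp) ≤ n^-p, and its zero set has expected size ≤ k·n·2^-m.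
module ToeplitzFamily (p q n Δ : ℕ) (p≥1 : 1 ≤ p) (q≥1 : 1 ≤ q) (n≥2 : 2 ≤ n) (Δ≥1 : 1 ≤ Δ) (Δ≤n : Δ ≤ n)
                      (g≤ℓΔ : ⌊log₂ n ⌋ / 16 + 1 ≤ ⌊log₂ Δ ⌋) where

  k ℓ ℓΔ g m L A R r : ℕ
  k  = 16 * p
  ℓ  = ⌊log₂ n ⌋
  ℓΔ = ⌊log₂ Δ ⌋
  g  = ℓ / 16 + 1
  m  = ℓΔ ∸ g
  L  = suc ℓ
  A  = m + L
  R  = A + m
  r  = k * R

  n≥1 : 1 ≤ n
  n≥1 = ≤-trans (s≤s z≤n) n≥2

  k≥1 : 1 ≤ k
  k≥1 = ≤-trans p≥1 (m≤n*m p 16)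

  n≤2^L : n ≤ 2 ^ L
  n≤2^L = <⇒≤ (<2^suc⌊log₂⌋ n)

  m+g≡ℓΔ : m + g ≡ ℓΔ
  m+g≡ℓΔ = m∸n+n≡m g≤ℓΔ

  m≤ℓ : m ≤ ℓ
  m≤ℓ = ≤-trans (m∸n≤m ℓΔ g) (⌊log₂⌋-mono-≤ Δ≤n)

  code : Fin n → Vec Bool L
  code u = bits L (inject≤ u n≤2^L)

  code-injective : ∀ {u v} → u ≢ v → code u ≢ code v
  code-injective u≢v eq = u≢v (inject≤-injective n≤2^L n≤2^L _ _ (bits-injective L _ _ eq))

  selected : Vec Bool R → Fin n → Bool
  selected s u = selects A m s (code u)

  open PairwiseIndependent n R (2 ^ m) selected (λ u → selects-single A m (code u))
         (λ u v u≢v → selects-pair A m (code u) (code v) (code-injective u≢v) ≤-refl)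
  open Repetition n R selected

  H : Fin (2 ^ r) → Fin n → Bool
  H i u = not (union k (bits r i) u)

  seed-length : r ≤ 4 * k * ℓ
  seed-length = seed-length-bound k m ℓ m≤ℓ (≤-trans (≤-reflexive (sym (⌊log₂[2^n]⌋≡n 1))) (⌊log₂⌋-mono-≤ n≥2))

  size : Vec Bool r → ℕ
  size s = ∑ᶠ n (λ u → 𝟙 (union k s u))

  -- The size threshold T = 3k·2^e, where 2^(e+m) = 2^L ≥ n, is three times the mean size.
  e T B : ℕ
  e = L ∸ m
  T = 3 * k * 2 ^ e
  B = (12 * k) ^ 16 * n ^ 17

  passes : Vec Bool r → Bool
  passes s = isYes (size s ^ 16 * Δ ^ 8 ≤? B)

  e+m≡L : e + m ≡ L
  e+m≡L = m∸n+n≡m (≤-trans m≤ℓ (n≤1+n ℓ))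

  T-passes : T ^ 16 * Δ ^ 8 ≤ B
  T-passes = subst (λ C → T ^ 16 * Δ ^ 8 ≤ C ^ 16 * n ^ 17) (twelve k)
    (threshold-bound 16 8 17 (3 * k) e ℓ ℓΔ Δ n (exponent-bound e m g ℓ ℓΔ e+m≡L m+g≡ℓΔ (8*[ℓ/16+1]≤ℓ+8 ℓ))
                     (<2^suc⌊log₂⌋ Δ) (2^⌊log₂⌋≤ n n≥1))
    where twelve : ∀ k → 3 * k * 4 ≡ 12 * k
          twelve = solve-∀

  3kn≤T·2^m : 3 * (k * n) ≤ T * 2 ^ m
  3kn≤T·2^m = begin
      3 * (k * n)               ≤⟨ *-monoʳ-≤ 3 (*-monoʳ-≤ k n≤2^L) ⟩
      3 * (k * 2 ^ L)           ≡⟨ cong (λ x → 3 * (k * 2 ^ x)) e+m≡L ⟨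
      3 * (k * 2 ^ (e + m))     ≡⟨ cong (λ x → 3 * (k * x)) (^-distribˡ-+-* 2 e m) ⟩
      3 * (k * (2 ^ e * 2 ^ m)) ≡⟨ regroup k (2 ^ e) (2 ^ m) ⟩
      T * 2 ^ m                 ∎
    where open ≤-Reasoning
          regroup : ∀ k x y → 3 * (k * (x * y)) ≡ 3 * k * x * y
          regroup = solve-∀

  passing-seeds : count (2 ^ r) (λ i → isYes (∣ Z (H i) ∣ ^ 16 * Δ ^ 8 ≤? B)) ≡ ∑ᵇ r (λ s → 𝟙 (passes s))
  passing-seeds = trans (count≡∑ᶠ (2 ^ r) _)
    (trans (∑ᶠ-cong (2 ^ r) (λ i → cong (λ x → 𝟙 (isYes (x ^ 16 * Δ ^ 8 ≤? B))) (∣Z∣ (union k (bits r i)))))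
           (∑ᶠ-bits r (λ s → 𝟙 (passes s))))

  passing+failing : ∑ᵇ r (λ s → 𝟙 (passes s)) + ∑ᵇ r (λ s → 𝟙 (not (passes s))) ≡ 2 ^ r
  passing+failing = trans (sym (∑ᵇ-+ r _ _))
    (trans (∑ᵇ-cong r (λ s → 𝟙-not (passes s))) (trans (∑ᵇ-const r 1) (*-identityʳ _)))

  -- By Markov's inequality at most a third of the seeds exceed the threshold.
  small-zero-sets : SmallZeroSets (12 * k) n Δ r H
  small-zero-sets = subst (λ c → 2 * 2 ^ r ≤ 3 * c) (sym passing-seeds)
    (two-thirds (∑ᵇ r (λ s → 𝟙 (passes s))) (∑ᵇ r (λ s → 𝟙 (not (passes s)))) (2 ^ r) passing+failing
      (markov r size (λ s → not (passes s)) T (2 ^ m) (k * n) (*-mono-≤ k≥1 n≥1)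
              (λ s → above-threshold 16 8 Δ T-passes) (union-size (2 ^ m) k expected-size) 3kn≤T·2^m))

  module _ (S : Subset n) where

    c z : ℕ
    c = count (2 ^ r) (λ i → not (hits (H i) S))
    z = ∑ᵇ R (λ s → 𝟙 (disjoint (lookup S) (selected s)))

    c-as-sum : c ≡ ∑ᵇ r (λ s → 𝟙 (not (hits (λ u → not (union k s u)) S)))
    c-as-sum = trans (count≡∑ᶠ (2 ^ r) _) (∑ᶠ-bits r (λ s → 𝟙 (not (hits (λ u → not (union k s u)) S))))

    c≤2^r : c ≤ 2 ^ r
    c≤2^r = subst (_≤ 2 ^ r) (sym c-as-sum) (∑ᵇ-𝟙≤ r _)

    -- The copies miss S independently.
    c≤z^k : c ≤ z ^ k
    c≤z^k = subst (_≤ z ^ k) (sym c-as-sum)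
      (≤-trans (∑ᵇ-mono r (λ s → miss-indicator (union k s) S)) (≤-reflexive (union-miss (lookup S) k)))

    -- One copy misses a set of size ≥ Δ ≥ 2^(m+g) with probability at most 2^-g.
    z·2^g≤2^R : Δ ≤ ∣ S ∣ → z * 2 ^ g ≤ 2 ^ R
    z·2^g≤2^R Δ≤∣S∣ = *-cancelˡ-≤ (2 ^ m) {{m^n≢0 2 m}} (begin
        2 ^ m * (z * 2 ^ g)   ≡⟨ regroup (2 ^ m) z (2 ^ g) ⟩
        z * (2 ^ m * 2 ^ g)   ≡⟨ cong (z *_) (trans (sym (^-distribˡ-+-* 2 m g)) (cong (2 ^_) m+g≡ℓΔ)) ⟩
        z * 2 ^ ℓΔ            ≤⟨ *-monoʳ-≤ z (≤-trans (2^⌊log₂⌋≤ Δ Δ≥1) Δ≤D) ⟩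
        z * D (lookup S)      ≤⟨ miss-bound (lookup S) (≤-trans Δ≥1 Δ≤D) ⟩
        2 ^ m * 2 ^ R         ∎)
      where open ≤-Reasoning
            Δ≤D : Δ ≤ D (lookup S)
            Δ≤D = ≤-trans Δ≤∣S∣ (≤-reflexive (∣∣≡∑ᶠ S))
            regroup : ∀ a z b → a * (z * b) ≡ z * (a * b)
            regroup = solve-∀

    -- Hence all k copies miss S with probability at most 2^(-g·16p) ≤ n^-p.
    rarely-missed : Δ ≤ ∣ S ∣ → c * n ^ p ≤ 2 ^ r
    rarely-missed Δ≤∣S∣ = begin
        c * n ^ p             ≤⟨ *-mono-≤ c≤z^k (n^p≤[2^g]^[16p] n p g L n≤2^L (ℓ<16*[ℓ/16+1] ℓ)) ⟩
        z ^ k * (2 ^ g) ^ k   ≡⟨ ^-distrib-* z (2 ^ g) k ⟨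
        (z * 2 ^ g) ^ k       ≤⟨ ^-monoˡ-≤ k (z·2^g≤2^R Δ≤∣S∣) ⟩
        (2 ^ R) ^ k           ≡⟨ trans (^-*-assoc 2 R k) (cong (2 ^_) (*-comm R k)) ⟩
        2 ^ r                 ∎
      where open ≤-Reasoning

  hits-large-sets : HitsLargeSets p q n Δ r H
  hits-large-sets S Δ≤∣S∣ = power-tail (c S) (2 ^ r) (n ^ p) q q≥1 (c≤2^r S) (rarely-missed S Δ≤∣S∣)

  family : HashFamily (4 * k) (12 * k) p q n Δ
  family = r , seed-length , H , small-zero-sets , hits-large-sets

-- With C₁ = 4k and C₂ = 12k for k = 16p, split on whether Δ is at least 2^g.
mainTheorem6 : (p q : ℕ) → 1 ≤ p → 1 ≤ q →
    Σ ℕ λ C₁ → Σ ℕ λ C₂ →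
    (n Δ : ℕ) → 2 ≤ n → 1 ≤ Δ → Δ ≤ n →
    Σ ℕ λ r → (r ≤ C₁ * ⌊log₂ n ⌋) ×
    Σ (Fin (2 ^ r) → Fin n → Bool) λ H →
      (2 * 2 ^ r ≤ 3 * count (2 ^ r) (λ i → isYes ((∣ Z (H i) ∣ ^ 16) * Δ ^ 8 ≤? (C₂ ^ 16) * n ^ 17)))
      × ((S : Subset n) → Δ ≤ ∣ S ∣ →
          (count (2 ^ r) (λ i → not (hits (H i) S)) ^ q) * n ^ p ≤ (2 ^ r) ^ q)
mainTheorem6 p q p≥1 q≥1 = 4 * (16 * p) , 12 * (16 * p) , family
  where
  family : (n Δ : ℕ) → 2 ≤ n → 1 ≤ Δ → Δ ≤ n → HashFamily (4 * (16 * p)) (12 * (16 * p)) p q n Δ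
  family n Δ n≥2 Δ≥1 Δ≤n with ⌊log₂ n ⌋ / 16 + 1 ≤? ⌊log₂ Δ ⌋
  ... | yes g≤ℓΔ = ToeplitzFamily.family p q n Δ p≥1 q≥1 n≥2 Δ≥1 Δ≤n g≤ℓΔ
  ... | no  g≰ℓΔ = TrivialFamily.family p q n Δ p≥1 q≥1 n≥2 Δ≥1 (≰⇒> g≰ℓΔ)
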